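{- Let $X$ be a $(95,40,12,20)$ strongly regular graph and let $K$ be a $4$-clique of $X$ that is not contained in any $5$-clique of $X$. For $i\in\{0,1,2,3\}$ let $X_i$ be the set of vertices of $V(X)\setminus V(K)$ having exactly $i$ neighbours in $K$, and suppose $(|X_0|,|X_1|,|X_2|,|X_3|)=(2,31,57,1)$. Then the unique vertex of $X_3$ is adjacent to both vertices of $X_0$.
   Context: A $k$-regular graph $G$ on $v$ vertices is a $(v,k,\lambda,\mu)$ strongly regular graph if any two distinct adjacent vertices have exactly $\lambda$ common neighbours and any two distinct non-adjacent vertices have exactly $\mu$ common neighbours. -}

module Defs where

open import Data.Nat using (ℕ)
open import Data.Fin using (Fin)
open import Data.List using (List; filter; length)
open import Data.List.Base using ()
open import Data.Fin.Base using ()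
open import Data.List using () renaming (allFin to allFinL)
open import Data.Product using (Σ; ∃; _×_; _,_)
open import Relation.Nullary using (¬_; Dec)
open import Relation.Nullary.Decidable using (_×-dec_; ¬?)
open import Relation.Binary.PropositionalEquality using (_≡_; _≢_)
open import Function.Definitions using (Injective)
open import Data.Fin.Properties using (any?) renaming (_≟_ to _≟F_)
import Data.Nat as N

record SimpleGraph (n : ℕ) : Set₁ where
  field
    Adj    : Fin n → Fin n → Set
    adj?   : ∀ u v → Dec (Adj u v)
    sym    : ∀ {u v} → Adj u v → Adj v u
    irrefl : ∀ {u} → ¬ Adj u u

module _ {n : ℕ} (G : SimpleGraph n) where
  open SimpleGraph G

  countV : (P : Fin n → Set) → (∀ v → Dec (P v)) → ℕ
  countV P P? = length (filter P? (allFinL n))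

  degree : Fin n → ℕ
  degree u = countV (Adj u) (adj? u)

  commonNbrs : Fin n → Fin n → ℕ
  commonNbrs u v = countV (λ w → Adj u w × Adj v w) (λ w → adj? u w ×-dec adj? v w)

  IsSRG : ℕ → ℕ → ℕ → ℕ → Set
  IsSRG v k l m =
    (n ≡ v)
    × (∀ u → degree u ≡ k)
    × (∀ u w → u ≢ w → Adj u w → commonNbrs u w ≡ l)
    × (∀ u w → u ≢ w → ¬ Adj u w → commonNbrs u w ≡ m)

  IsClique : {r : ℕ} → (Fin r → Fin n) → Set
  IsClique {r} f = Injective _≡_ _≡_ f × (∀ i j → i ≢ j → Adj (f i) (f j))

  ContainedInClique : {s : ℕ} → (Fin s → Fin n) → ℕ → Set
  ContainedInClique {s} K r =
    Σ (Fin r → Fin n) λ f → IsClique f × (∀ i → ∃ λ j → f j ≡ K i)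

  InK : {s : ℕ} → (Fin s → Fin n) → Fin n → Set
  InK {s} K v = ∃ λ i → K i ≡ v

  nbrsInK : {s : ℕ} → (Fin s → Fin n) → Fin n → ℕ
  nbrsInK {s} K v = length (filter (λ i → adj? v (K i)) (allFinL s))

  InX : {s : ℕ} → (Fin s → Fin n) → ℕ → Fin n → Set
  InX K i v = ¬ InK K v × nbrsInK K v ≡ i

  InK? : {s : ℕ} → (K : Fin s → Fin n) → ∀ v → Dec (InK K v)
  InK? K v = any? (λ i → K i ≟F v)

  InX? : {s : ℕ} → (K : Fin s → Fin n) → (i : ℕ) → ∀ v → Dec (InX K i v)
  InX? K i v = ¬? (InK? K v) ×-dec (nbrsInK K v N.≟ i)

  sizeX : {s : ℕ} → (Fin s → Fin n) → ℕ → ℕ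
  sizeX K i = countV (InX K i) (InX? K i)

-- Let x be the vertex of X₃ and y, y' the two vertices of X₀. Counting the
-- pairs (z, i) with z ~ y and z ~ K i in two ways gives 4μ = 80 = Σ_{z ~ y} |N(z) ∩ K|.
-- No neighbour z of y lies in K, and |N(z) ∩ K| ≠ 4 by maximality of K, so
-- |N(z) ∩ K| ≤ 1 + [z ∈ X₂] + 2 [z ∈ X₃], whence 40 ≤ a + 2b, where a and b
-- count the neighbours of y in X₂ and in X₃. If x ≁ y then b = 0, so y has at
-- least 40 neighbours in X₂, while y' has at least 38. But y and y' have at most
-- 20 common neighbours, so together they see at most 57 + 20 = 77 vertices of X₂.
module Submission where

open import Defs
open import Data.Bool.Base using (true; false)
open import Data.Empty using (⊥)
open import Data.Fin.Base using (Fin; zero; suc; punchIn)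
open import Data.Fin.Properties using (¬∀⟶∃¬; punchInᵢ≢i)
open import Data.List.Base using (filter; length; tabulate)
open import Data.Nat.Base using (ℕ; zero; suc; _+_; _*_; _⊔_; _≤_; _<_; z≤n; s≤s; s≤s⁻¹)
open import Data.Nat.Properties
open import Data.Nat.Tactic.RingSolver using (solve-∀)
open import Data.Product using (∃; _×_; _,_)
open import Data.Vec.Functional using (Vector; _∷_; removeAt)
open import Function.Base using (_∘_; id)
open import Function.Definitions using (Injective)
open import Relation.Nullary using (¬_; Dec; yes; no; _because_; contradiction)
open import Relation.Nullary.Decidable using (_×-dec_; ¬?; decidable-stable)
open import Relation.Binary.PropositionalEquality

open import Algebra.Properties.Semiring.Sum +-*-semiring
  using (sum; sum-syntax; sum-remove; ∑-comm; ∑-distrib-+; *-distribˡ-sum; sum-cong-≗)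

𝟙 : ∀ {p} {P : Set p} → Dec P → ℕ
𝟙 (true because _)  = 1
𝟙 (false because _) = 0

module _ {p} {P : Set p} where

  𝟙≤1 : (d : Dec P) → 𝟙 d ≤ 1
  𝟙≤1 (yes _) = s≤s z≤n
  𝟙≤1 (no _)  = z≤n

  𝟙-yes : (d : Dec P) → P → 𝟙 d ≡ 1
  𝟙-yes (yes _) _  = refl
  𝟙-yes (no ¬p) p = contradiction p ¬p

  𝟙-no : (d : Dec P) → ¬ P → 𝟙 d ≡ 0
  𝟙-no (yes p) ¬p = contradiction p ¬p
  𝟙-no (no _)  _  = refl

  𝟙*≤ : (d : Dec P) (m : ℕ) → 𝟙 d * m ≤ m
  𝟙*≤ (yes _) m = ≤-reflexive (+-identityʳ m)
  𝟙*≤ (no _)  m = z≤n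

  𝟙-*-mono : (d : Dec P) {m o : ℕ} → (P → m ≤ o) → 𝟙 d * m ≤ 𝟙 d * o
  𝟙-*-mono (yes p) m≤o = *-monoʳ-≤ 1 (m≤o p)
  𝟙-*-mono (no _)  _   = z≤n

module _ {p q} {P : Set p} {Q : Set q} where

  𝟙-cong : (P → Q) → (Q → P) → (p : Dec P) (q : Dec Q) → 𝟙 p ≡ 𝟙 q
  𝟙-cong _   _   (yes _)  (yes _)  = refl
  𝟙-cong _   _   (no _)   (no _)   = refl
  𝟙-cong P⇒Q _   (yes p)  (no ¬q)  = contradiction (P⇒Q p) ¬q
  𝟙-cong _   Q⇒P (no ¬p)  (yes q)  = contradiction (Q⇒P q) ¬p

  𝟙-×-dec : (p : Dec P) (q : Dec Q) → 𝟙 (p ×-dec q) ≡ 𝟙 p * 𝟙 q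
  𝟙-×-dec (yes _) (yes _) = refl
  𝟙-×-dec (yes _) (no _)  = refl
  𝟙-×-dec (no _)  _       = refl

𝟙-overlap : ∀ {a b c} {A : Set a} {B : Set b} {C : Set c} (p : Dec A) (q : Dec B) (r : Dec C) →
            𝟙 p * 𝟙 r + 𝟙 q * 𝟙 r ≤ 𝟙 r + 𝟙 p * 𝟙 q
𝟙-overlap (yes _) (yes _) (yes _) = ≤-refl
𝟙-overlap (yes _) (yes _) (no _)  = z≤n
𝟙-overlap (yes _) (no _)  (yes _) = ≤-refl
𝟙-overlap (yes _) (no _)  (no _)  = z≤n
𝟙-overlap (no _)  (yes _) (yes _) = ≤-refl
𝟙-overlap (no _)  (yes _) (no _)  = z≤n
𝟙-overlap (no _)  (no _)  (yes _) = z≤n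
𝟙-overlap (no _)  (no _)  (no _)  = z≤n

∑-const : ∀ n c → ∑[ i < n ] c ≡ n * c
∑-const zero    c = refl
∑-const (suc n) c = cong (c +_) (∑-const n c)

∑-mono-≤ : ∀ {n} {f g : Vector ℕ n} → (∀ i → f i ≤ g i) → sum f ≤ sum g
∑-mono-≤ {zero}  _   = z≤n
∑-mono-≤ {suc n} f≤g = +-mono-≤ (f≤g zero) (∑-mono-≤ (f≤g ∘ suc))

∑-mono-< : ∀ {n} {f g : Vector ℕ n} (i : Fin n) → (∀ j → f j ≤ g j) → f i < g i →
           sum f < sum g
∑-mono-< {suc n} {f} {g} i f≤g fi<gi = begin-strict
  sum f                     ≡⟨ sum-remove {i = i} f ⟩
  f i + sum (removeAt f i)  <⟨ +-mono-<-≤ fi<gi (∑-mono-≤ (f≤g ∘ punchIn i)) ⟩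
  g i + sum (removeAt g i)  ≡⟨ sum-remove {i = i} g ⟨
  sum g                     ∎
  where open ≤-Reasoning

term≤∑ : ∀ {n} (f : Vector ℕ n) (i : Fin n) → f i ≤ sum f
term≤∑ {suc n} f i = ≤-trans (m≤m+n (f i) _) (≤-reflexive (sym (sum-remove {i = i} f)))

module _ {p} {n} {P : Fin n → Set p} (P? : ∀ i → Dec (P i)) where

  ∑𝟙≡n⇒∀ : ∑[ i < n ] 𝟙 (P? i) ≡ n → ∀ i → P i
  ∑𝟙≡n⇒∀ ∑≡n i = decidable-stable (P? i) λ ¬Pi → <-irrefl ∑≡n (begin-strict
    ∑[ j < n ] 𝟙 (P? j)  <⟨ ∑-mono-< i (𝟙≤1 ∘ P?) (≤-reflexive (cong suc (𝟙-no (P? i) ¬Pi))) ⟩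
    ∑[ j < n ] 1         ≡⟨ ∑-const n 1 ⟩
    n * 1                ≡⟨ *-identityʳ n ⟩
    n                    ∎)
    where open ≤-Reasoning

  ∑𝟙>0⇒∃ : 0 < ∑[ i < n ] 𝟙 (P? i) → ∃ P
  ∑𝟙>0⇒∃ ∑>0 =
    let i , ¬¬Pi = ¬∀⟶∃¬ n (¬_ ∘ P) (¬? ∘ P?) ¬∀¬P in i , decidable-stable (P? i) ¬¬Pi
    where
    ¬∀¬P : ¬ (∀ i → ¬ P i)
    ¬∀¬P ∀¬P = <-irrefl (sym (begin
      ∑[ i < n ] 𝟙 (P? i)  ≡⟨ sum-cong-≗ (λ i → 𝟙-no (P? i) (∀¬P i)) ⟩
      ∑[ i < n ] 0         ≡⟨ ∑-const n 0 ⟩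
      n * 0                ≡⟨ *-zeroʳ n ⟩
      0                    ∎)) ∑>0
      where open ≡-Reasoning

∑𝟙≥2⇒∃-other : ∀ {p n} {P : Fin n → Set p} (P? : ∀ i → Dec (P i)) {y : Fin n} →
                2 ≤ ∑[ i < n ] 𝟙 (P? i) → P y → ∃ λ y' → y' ≢ y × P y'
∑𝟙≥2⇒∃-other {n = suc n} P? {y} 2≤∑ Py =
  let j , Pj = ∑𝟙>0⇒∃ (P? ∘ punchIn y) (s≤s⁻¹ 2≤1+rest)
  in punchIn y j , punchInᵢ≢i y j , Pj
  where
  rest : ℕ
  rest = ∑[ j < n ] 𝟙 (P? (punchIn y j))
  2≤1+rest : 2 ≤ 1 + rest
  2≤1+rest = begin
    2                        ≤⟨ 2≤∑ ⟩
    ∑[ i < suc n ] 𝟙 (P? i)  ≡⟨ sum-remove {i = y} (𝟙 ∘ P?) ⟩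
    𝟙 (P? y) + rest          ≡⟨ cong (_+ rest) (𝟙-yes (P? y) Py) ⟩
    1 + rest                 ∎
    where open ≤-Reasoning

length-filter-tabulate : ∀ {a p} {A : Set a} {P : A → Set p} (P? : ∀ x → Dec (P x))
                         {n} (f : Fin n → A) →
                         length (filter P? (tabulate f)) ≡ ∑[ i < n ] 𝟙 (P? (f i))
length-filter-tabulate P? {zero}  f = refl
length-filter-tabulate P? {suc n} f with P? (f zero)
... | yes _ = cong suc (length-filter-tabulate P? (f ∘ suc))
... | no _  = length-filter-tabulate P? (f ∘ suc)

module _ {n} (G : SimpleGraph n) where
  open SimpleGraph G renaming (sym to adj-sym)

  countV≡∑ : (P : Fin n → Set) (P? : ∀ v → Dec (P v)) → countV G P P? ≡ ∑[ v < n ] 𝟙 (P? v)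
  countV≡∑ P P? = length-filter-tabulate P? id

  nbrsInK≡∑ : ∀ {s} (K : Fin s → Fin n) v → nbrsInK G K v ≡ ∑[ i < s ] 𝟙 (adj? v (K i))
  nbrsInK≡∑ K v = length-filter-tabulate (λ i → adj? v (K i)) id

  countV≥2⇒∃-other : {P : Fin n → Set} (P? : ∀ v → Dec (P v)) {y : Fin n} →
                     2 ≤ countV G P P? → P y → ∃ λ y' → y' ≢ y × P y'
  countV≥2⇒∃-other P? 2≤count = ∑𝟙≥2⇒∃-other P? (subst (2 ≤_) (countV≡∑ _ P?) 2≤count)

  𝟙-adj-sym : ∀ u v → 𝟙 (adj? u v) ≡ 𝟙 (adj? v u)
  𝟙-adj-sym u v = 𝟙-cong adj-sym adj-sym (adj? u v) (adj? v u)

  commonNbrs≡∑ : ∀ u v → commonNbrs G u v ≡ ∑[ w < n ] (𝟙 (adj? u w) * 𝟙 (adj? v w))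
  commonNbrs≡∑ u v = trans (countV≡∑ _ _) (sum-cong-≗ λ w → 𝟙-×-dec (adj? u w) (adj? v w))

  nbrsIn : Fin n → {P : Fin n → Set} → (∀ v → Dec (P v)) → ℕ
  nbrsIn u P? = ∑[ w < n ] (𝟙 (adj? u w) * 𝟙 (P? w))

  module _ {P : Fin n → Set} (P? : ∀ v → Dec (P v)) where

    nbrsIn≤countV : ∀ u → nbrsIn u P? ≤ countV G P P?
    nbrsIn≤countV u = begin
      nbrsIn u P?          ≤⟨ ∑-mono-≤ (λ w → 𝟙*≤ (adj? u w) (𝟙 (P? w))) ⟩
      ∑[ w < n ] 𝟙 (P? w)  ≡⟨ countV≡∑ P P? ⟨
      countV G P P?        ∎
      where open ≤-Reasoning

    nbrsIn<countV : ∀ {u x} → P x → ¬ Adj u x → nbrsIn u P? < countV G P P?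
    nbrsIn<countV {u} {x} Px u≁x = begin-strict
      nbrsIn u P?          <⟨ ∑-mono-< x (λ w → 𝟙*≤ (adj? u w) (𝟙 (P? w))) x-term ⟩
      ∑[ w < n ] 𝟙 (P? w)  ≡⟨ countV≡∑ P P? ⟨
      countV G P P?        ∎
      where
      open ≤-Reasoning
      x-term : 𝟙 (adj? u x) * 𝟙 (P? x) < 𝟙 (P? x)
      x-term rewrite 𝟙-no (adj? u x) u≁x | 𝟙-yes (P? x) Px = s≤s z≤n

    nbrsIn+nbrsIn≤countV+commonNbrs : ∀ u w →
      nbrsIn u P? + nbrsIn w P? ≤ countV G P P? + commonNbrs G u w
    nbrsIn+nbrsIn≤countV+commonNbrs u w = begin
      nbrsIn u P? + nbrsIn w P?
        ≡⟨ ∑-distrib-+ (λ z → 𝟙 (adj? u z) * 𝟙 (P? z)) (λ z → 𝟙 (adj? w z) * 𝟙 (P? z)) ⟨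
      ∑[ z < n ] (𝟙 (adj? u z) * 𝟙 (P? z) + 𝟙 (adj? w z) * 𝟙 (P? z))
        ≤⟨ ∑-mono-≤ (λ z → 𝟙-overlap (adj? u z) (adj? w z) (P? z)) ⟩
      ∑[ z < n ] (𝟙 (P? z) + 𝟙 (adj? u z) * 𝟙 (adj? w z))
        ≡⟨ ∑-distrib-+ (𝟙 ∘ P?) (λ z → 𝟙 (adj? u z) * 𝟙 (adj? w z)) ⟩
      ∑[ z < n ] 𝟙 (P? z) + ∑[ z < n ] (𝟙 (adj? u z) * 𝟙 (adj? w z))
        ≡⟨ cong₂ _+_ (countV≡∑ P P?) (commonNbrs≡∑ u w) ⟨
      countV G P P? + commonNbrs G u w
        ∎
      where open ≤-Reasoning

  commonNbrs≤λ⊔μ : ∀ {v k l m} → IsSRG G v k l m → ∀ {u w} → u ≢ w → commonNbrs G u w ≤ l ⊔ m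
  commonNbrs≤λ⊔μ {l = l} {m} (_ , _ , common-adj , common-nonadj) {u} {w} u≢w with adj? u w
  ... | yes u~w = ≤-trans (≤-reflexive (common-adj u w u≢w u~w)) (m≤m⊔n l m)
  ... | no u≁w  = ≤-trans (≤-reflexive (common-nonadj u w u≢w u≁w)) (m≤n⊔m l m)

  module _ {s} {K : Fin s → Fin n} where

    extend-clique : ∀ {v} → IsClique G K → ¬ InK G K v → (∀ i → Adj v (K i)) →
                    ContainedInClique G K (suc s)
    extend-clique {v} (K-inj , K-adj) v∉K v~K = v ∷ K , (inj , adj) , λ i → suc i , refl
      where
      inj : Injective _≡_ _≡_ (v ∷ K)
      inj {zero}  {zero}  _     = refl
      inj {zero}  {suc j} v≡Kj  = contradiction (j , sym v≡Kj) v∉K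
      inj {suc i} {zero}  Ki≡v  = contradiction (i , Ki≡v) v∉K
      inj {suc i} {suc j} Ki≡Kj = cong suc (K-inj Ki≡Kj)
      adj : ∀ i j → i ≢ j → Adj ((v ∷ K) i) ((v ∷ K) j)
      adj zero    zero    i≢i = contradiction refl i≢i
      adj zero    (suc j) _   = v~K j
      adj (suc i) zero    _   = adj-sym (v~K i)
      adj (suc i) (suc j) i≢j = K-adj i j (i≢j ∘ cong suc)

    nbrsInK≤size : ∀ v → nbrsInK G K v ≤ s
    nbrsInK≤size v = begin
      nbrsInK G K v               ≡⟨ nbrsInK≡∑ K v ⟩
      ∑[ i < s ] 𝟙 (adj? v (K i)) ≤⟨ ∑-mono-≤ (λ i → 𝟙≤1 (adj? v (K i))) ⟩
      ∑[ i < s ] 1                ≡⟨ ∑-const s 1 ⟩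
      s * 1                       ≡⟨ *-identityʳ s ⟩
      s                           ∎
      where open ≤-Reasoning

    nbrsInK≢size : ∀ {v} → IsClique G K → ¬ ContainedInClique G K (suc s) → ¬ InK G K v →
                   nbrsInK G K v ≢ s
    nbrsInK≢size {v} K-clique K-maximal v∉K ≡s =
      K-maximal (extend-clique K-clique v∉K
        (∑𝟙≡n⇒∀ (λ i → adj? v (K i)) (trans (sym (nbrsInK≡∑ K v)) ≡s)))

    nbrsInK≡0⇒≁ : ∀ {v} → nbrsInK G K v ≡ 0 → ∀ i → ¬ Adj v (K i)
    nbrsInK≡0⇒≁ {v} ≡0 i v~Ki = 1+n≰n (begin
      1                           ≡⟨ 𝟙-yes (adj? v (K i)) v~Ki ⟨
      𝟙 (adj? v (K i))            ≤⟨ term≤∑ (λ j → 𝟙 (adj? v (K j))) i ⟩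
      ∑[ j < s ] 𝟙 (adj? v (K j)) ≡⟨ nbrsInK≡∑ K v ⟨
      nbrsInK G K v               ≡⟨ ≡0 ⟩
      0                           ∎)
      where open ≤-Reasoning

    ∑-nbrs-nbrsInK : ∀ {μ} y → (∀ i → commonNbrs G y (K i) ≡ μ) →
                     ∑[ z < n ] (𝟙 (adj? y z) * nbrsInK G K z) ≡ s * μ
    ∑-nbrs-nbrsInK {μ} y common≡μ = begin
      ∑[ z < n ] (𝟙 (adj? y z) * nbrsInK G K z)
        ≡⟨ sum-cong-≗ (λ z → trans (cong (𝟙 (adj? y z) *_) (nbrsInK≡∑ K z))
                                   (*-distribˡ-sum (𝟙 (adj? y z)) (λ i → 𝟙 (adj? z (K i))))) ⟩
      ∑[ z < n ] ∑[ i < s ] (𝟙 (adj? y z) * 𝟙 (adj? z (K i)))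
        ≡⟨ ∑-comm (λ z i → 𝟙 (adj? y z) * 𝟙 (adj? z (K i))) ⟩
      ∑[ i < s ] ∑[ z < n ] (𝟙 (adj? y z) * 𝟙 (adj? z (K i)))
        ≡⟨ sum-cong-≗ (λ i → sum-cong-≗ λ z → cong (𝟙 (adj? y z) *_) (𝟙-adj-sym z (K i))) ⟩
      ∑[ i < s ] ∑[ z < n ] (𝟙 (adj? y z) * 𝟙 (adj? (K i) z))
        ≡⟨ sum-cong-≗ (λ i → trans (sym (commonNbrs≡∑ y (K i))) (common≡μ i)) ⟩
      ∑[ i < s ] μ
        ≡⟨ ∑-const s μ ⟩
      s * μ
        ∎
      where open ≡-Reasoning

    X₀-commonNbrs : ∀ {v k l m y} → IsSRG G v k l m → InX G K 0 y → ∀ i → commonNbrs G y (K i) ≡ m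
    X₀-commonNbrs {y = y} (_ , _ , _ , common-nonadj) (y∉K , y₀) i =
      common-nonadj y (K i) (λ y≡Ki → y∉K (i , sym y≡Ki)) (nbrsInK≡0⇒≁ y₀ i)

  module _ {K : Fin 4 → Fin n} (K-clique : IsClique G K) (K-maximal : ¬ ContainedInClique G K 5) where

    nbrsInK≤1+X₂+2X₃ : ∀ {z} → ¬ InK G K z →
                       nbrsInK G K z ≤ 1 + 𝟙 (InX? G K 2 z) + 2 * 𝟙 (InX? G K 3 z)
    nbrsInK≤1+X₂+2X₃ {z} z∉K = begin
      g                                  ≤⟨ ≤3⇒≤1+[≡2]+2[≡3] g g≤3 ⟩
      1 + 𝟙 (g ≟ 2) + 2 * 𝟙 (g ≟ 3)      ≡⟨ cong₂ (λ a b → 1 + a + 2 * b) (𝟙-InX 2) (𝟙-InX 3) ⟨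
      1 + 𝟙 (InX? G K 2 z) + 2 * 𝟙 (InX? G K 3 z) ∎
      where
      open ≤-Reasoning
      g = nbrsInK G K z
      g≤3 : g ≤ 3
      g≤3 = s≤s⁻¹ (≤∧≢⇒< (nbrsInK≤size z) (nbrsInK≢size K-clique K-maximal z∉K))
      ≤3⇒≤1+[≡2]+2[≡3] : ∀ m → m ≤ 3 → m ≤ 1 + 𝟙 (m ≟ 2) + 2 * 𝟙 (m ≟ 3)
      ≤3⇒≤1+[≡2]+2[≡3] 0 _ = z≤n
      ≤3⇒≤1+[≡2]+2[≡3] 1 _ = ≤-refl
      ≤3⇒≤1+[≡2]+2[≡3] 2 _ = ≤-refl
      ≤3⇒≤1+[≡2]+2[≡3] 3 _ = ≤-refl
      ≤3⇒≤1+[≡2]+2[≡3] (suc (suc (suc (suc _)))) (s≤s (s≤s (s≤s ())))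
      𝟙-InX : ∀ i → 𝟙 (InX? G K i z) ≡ 𝟙 (g ≟ i)
      𝟙-InX i = 𝟙-cong (λ (_ , g≡i) → g≡i) (z∉K ,_) (InX? G K i z) (g ≟ i)

    X₀-bound : ∀ {v k l m y} → IsSRG G v k l m → InX G K 0 y →
               4 * m ≤ k + nbrsIn y (InX? G K 2) + 2 * nbrsIn y (InX? G K 3)
    X₀-bound {k = k} {m = m} {y} srg@(_ , regular , _ , _) y∈X₀@(_ , y₀) = begin
      4 * m
        ≡⟨ ∑-nbrs-nbrsInK y (X₀-commonNbrs srg y∈X₀) ⟨
      ∑[ z < n ] (a z * nbrsInK G K z)
        ≤⟨ ∑-mono-≤ (λ z → 𝟙-*-mono (adj? y z) (nbrsInK≤1+X₂+2X₃ ∘ nbr∉K z)) ⟩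
      ∑[ z < n ] (a z * (1 + b₂ z + 2 * b₃ z))
        ≡⟨ sum-cong-≗ (λ z → expand (a z) (b₂ z) (b₃ z)) ⟩
      ∑[ z < n ] (a z + a z * b₂ z + 2 * (a z * b₃ z))
        ≡⟨ ∑-distrib-+ (λ z → a z + a z * b₂ z) (λ z → 2 * (a z * b₃ z)) ⟩
      ∑[ z < n ] (a z + a z * b₂ z) + ∑[ z < n ] (2 * (a z * b₃ z))
        ≡⟨ cong₂ _+_ (∑-distrib-+ a (λ z → a z * b₂ z)) (sym (*-distribˡ-sum 2 (λ z → a z * b₃ z))) ⟩
      sum a + nbrsIn y (InX? G K 2) + 2 * nbrsIn y (InX? G K 3)
        ≡⟨ cong (λ d → d + nbrsIn y (InX? G K 2) + 2 * nbrsIn y (InX? G K 3))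
                (trans (sym (countV≡∑ (Adj y) (adj? y))) (regular y)) ⟩
      k + nbrsIn y (InX? G K 2) + 2 * nbrsIn y (InX? G K 3)
        ∎
      where
      open ≤-Reasoning
      a b₂ b₃ : Fin n → ℕ
      a z = 𝟙 (adj? y z)
      b₂ z = 𝟙 (InX? G K 2 z)
      b₃ z = 𝟙 (InX? G K 3 z)
      nbr∉K : ∀ z → Adj y z → ¬ InK G K z
      nbr∉K z y~z (i , Ki≡z) = nbrsInK≡0⇒≁ y₀ i (subst (Adj y) (sym Ki≡z) y~z)
      expand : ∀ a b c → a * (1 + b + 2 * c) ≡ a + a * b + 2 * (a * c)
      expand = solve-∀

X₂-overcrowded : ∀ {a a' b b' c} → 80 ≤ 40 + a + 2 * b → 80 ≤ 40 + a' + 2 * b' →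
                 b < 1 → b' ≤ 1 → a + a' ≤ 57 + c → c ≤ 20 → ⊥
X₂-overcrowded {a} {a'} {b' = b'} {c} y-bound y'-bound (s≤s z≤n) b'≤1 a+a'≤ c≤20 = 1+n≰n (begin
  160                                ≤⟨ +-mono-≤ y-bound y'-bound ⟩
  40 + a + 0 + (40 + a' + 2 * b')    ≤⟨ +-monoʳ-≤ (40 + a + 0) (+-monoʳ-≤ (40 + a') (*-monoʳ-≤ 2 b'≤1)) ⟩
  40 + a + 0 + (40 + a' + 2)         ≡⟨ regroup a a' ⟩
  82 + (a + a')                      ≤⟨ +-monoʳ-≤ 82 (≤-trans a+a'≤ (+-monoʳ-≤ 57 c≤20)) ⟩
  159                                ∎)
  where
  open ≤-Reasoning
  regroup : ∀ a a' → 40 + a + 0 + (40 + a' + 2) ≡ 82 + (a + a')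
  regroup = solve-∀

lemma11 : (X : SimpleGraph 95) → IsSRG X 95 40 12 20 →
    (K : Fin 4 → Fin 95) → IsClique X K → ¬ ContainedInClique X K 5 →
    sizeX X K 0 ≡ 2 → sizeX X K 1 ≡ 31 → sizeX X K 2 ≡ 57 → sizeX X K 3 ≡ 1 →
    ∀ x y → InX X K 3 x → InX X K 0 y → SimpleGraph.Adj X x y
lemma11 X srg K K-clique K-maximal |X₀| _ |X₂| |X₃| x y x∈X₃ y∈X₀ =
  decidable-stable (adj? x y) λ x≁y →
    let y' , y'≢y , y'∈X₀ = countV≥2⇒∃-other X (InX? X K 0) (≤-reflexive (sym |X₀|)) y∈X₀
    in X₂-overcrowded {X₂-nbrs y} {X₂-nbrs y'} {X₃-nbrs y} {X₃-nbrs y'} {commonNbrs X y y'}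
      (X₀-bound X K-clique K-maximal srg y∈X₀)
      (X₀-bound X K-clique K-maximal srg y'∈X₀)
      (subst (X₃-nbrs y <_) |X₃| (nbrsIn<countV X (InX? X K 3) x∈X₃ (x≁y ∘ adj-sym)))
      (subst (X₃-nbrs y' ≤_) |X₃| (nbrsIn≤countV X (InX? X K 3) y'))
      (subst (λ s → X₂-nbrs y + X₂-nbrs y' ≤ s + commonNbrs X y y') |X₂|
        (nbrsIn+nbrsIn≤countV+commonNbrs X (InX? X K 2) y y'))
      (commonNbrs≤λ⊔μ X srg (y'≢y ∘ sym))
  where
  open SimpleGraph X renaming (sym to adj-sym)
  X₂-nbrs X₃-nbrs : Fin 95 → ℕ
  X₂-nbrs u = nbrsIn X u (InX? X K 2)
  X₃-nbrs u = nbrsIn X u (InX? X K 3)
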